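{- Let $k\ge 3$, $n\ge k$ and $L\ge 0$ be integers. Let $A$ be chosen uniformly at random from the set $M_{L,n,k}$ of Boolean $L\times n$ matrices with exactly $k$ ones in each row, let $Y(A)$ be the number of vectors in the kernel of $A^{T}$ over $GF(2)$, and let $E_{L,k}(Y)$ be its expectation. For $0\le m\le n$ set $$\omega_{n,m,k}=\sum_{s=0}^{k}(-1)^s\binom{m}{s}\binom{n-m}{k-s}.$$ Then $$E_{L,k}(Y)=2^{ -n}\sum_{m=0}^{n}\binom nm\Bigl(1+\frac{\omega_{n,m,k}}{\binom nk}\Bigr)^{L}.$$
   Context: Binomial coefficients $\binom{a}{b}$ are $0$ when $b>a$ or $b<0$. -}

module Defs where

open import Data.Bool using (Bool; true; false; _∧_; _xor_)
open import Data.Nat using (ℕ; zero; suc; _∸_; _≡ᵇ_)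
open import Data.Nat.Combinatorics using (_C_)
open import Data.Integer as ℤ using (ℤ; +_)
open import Data.Rational as ℚ using (ℚ; 0ℚ; 1ℚ)
open import Data.List using (List; []; _∷_; map; concatMap; filter; length; foldr; upTo)
open import Data.Vec as Vec using (Vec; []; _∷_)
open import Data.Fin using (Fin)
open import Data.Fin.Properties using (all?)
open import Relation.Nullary.Decidable using (does)
open import Relation.Binary.PropositionalEquality using (_≡_)
open import Data.Bool.Properties using () renaming (_≟_ to _≟𝔹_)
open import Data.Nat.Properties using () renaming (_≟_ to _≟ℕ_)

allVecs : (n : ℕ) → List (Vec Bool n)
allVecs zero = [] ∷ []
allVecs (suc n) = concatMap (λ v → (false ∷ v) ∷ (true ∷ v) ∷ []) (allVecs n)

ones : ∀ {n} → Vec Bool n → ℕ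
ones [] = 0
ones (true ∷ v) = suc (ones v)
ones (false ∷ v) = ones v

tuples : ∀ {A : Set} → (L : ℕ) → List A → List (Vec A L)
tuples zero xs = [] ∷ []
tuples (suc L) xs = concatMap (λ x → map (x ∷_) (tuples L xs)) xs

Matrix : ℕ → ℕ → Set
Matrix L n = Vec (Vec Bool n) L

-- M_{L,n,k}: all Boolean L×n matrices with exactly k ones in each row
-- (enumerated without repetition).
M : (L n k : ℕ) → List (Matrix L n)
M L n k = tuples L (filter (λ r → ones r ≟ℕ k) (allVecs n))

entry : ∀ {L n} → Matrix L n → Fin L → Fin n → Bool
entry A i j = Vec.lookup (Vec.lookup A i) j

ATx : ∀ {L n} → Matrix L n → Vec Bool L → Fin n → Bool
ATx {L} A x j = Vec.foldr _ _xor_ false (Vec.tabulate (λ i → entry A i j ∧ Vec.lookup x i))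

inKerAT : ∀ {L n} → (A : Matrix L n) → (x : Vec Bool L) → Set
inKerAT A x = ∀ j → ATx A x j ≡ false

Y : ∀ {L n} → Matrix L n → ℕ
Y {L} {n} A = length (filter (λ x → all? (λ j → ATx A x j ≟𝔹 false)) (allVecs L))

-- a / d in ℚ, with the convention a / 0 = 0 (only used with d ≠ 0).
divℚ : ℤ → ℕ → ℚ
divℚ a zero = 0ℚ
divℚ a (suc d) = a ℚ./ suc d

E : (L n k : ℕ) → ℚ
E L n k = divℚ (+ foldr (λ A s → Y A Data.Nat.+ s) 0 (M L n k)) (length (M L n k))

_^ℚ_ : ℚ → ℕ → ℚ
q ^ℚ zero = 1ℚ
q ^ℚ suc m = q ℚ.* (q ^ℚ m)

sign : ℕ → ℤ
sign zero = + 1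
sign (suc s) = ℤ.- sign s

sumℤ : ℕ → (ℕ → ℤ) → ℤ
sumℤ N f = foldr (λ i s → f i ℤ.+ s) (+ 0) (upTo (suc N))

sumℚ : ℕ → (ℕ → ℚ) → ℚ
sumℚ N f = foldr (λ i s → f i ℚ.+ s) 0ℚ (upTo (suc N))

ω : ℕ → ℕ → ℕ → ℤ
ω n m k = sumℤ k (λ s → sign s ℤ.* + ((m C s) Data.Nat.* ((n ∸ m) C (k ∸ s))))

{-# OPTIONS --safe #-}
module Submission where

-- Character orthogonality over GF(2) gives
--   2ⁿ Y(A) = Σ_{u ∈ GF(2)ⁿ} Σ_{x ∈ GF(2)ᴸ} (-1)^(u·Aᵀx) = Σ_u Π_{rows r of A} (1 + (-1)^(u·r)).
-- The rows of a matrix in M_{L,n,k} range independently over the C(n,k) vectors of weight k,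
-- so summing over M_{L,n,k} turns the product into (C(n,k) + K(u))ᴸ with the Krawtchouk
-- number K(u) = Σ_{|r| = k} (-1)^(u·r). It depends only on the weight m of u and equals
-- ω_{n,m,k}: both are the coefficient of xᵏ in (1 - x)ᵐ (1 + x)ⁿ⁻ᵐ. Grouping u by weight and
-- dividing by |M_{L,n,k}| = C(n,k)ᴸ gives the formula.

open import Defs
open import Algebra.Bundles using (CommutativeMonoid; CommutativeRing)
open import Data.Bool using (Bool; true; false; _∧_; _xor_)
open import Data.Bool.Properties
  using (∧-assoc; ∧-zeroʳ; ∧-identityʳ; ∧-distribˡ-xor; ∧-distribʳ-xor; xor-∧-commutativeRing)
  renaming (_≟_ to _≟𝔹_)
open import Data.Fin using (Fin; zero; suc)
open import Data.Fin.Properties using (all?)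
open import Data.Integer as ℤ using (ℤ; +_; 0ℤ; 1ℤ; -1ℤ; _+_; _*_; -_; _-_; _^_)
import Data.Integer.Properties as ℤ
open import Data.Integer.Tactic.RingSolver using (solve-∀)
open import Data.List
  using (List; []; _∷_; _++_; map; concatMap; filter; length; foldr; upTo; applyUpTo)
open import Data.List.Properties using (map-applyUpTo; foldr-fusion)
open import Data.Nat as ℕ using (ℕ; zero; suc; _∸_; _≡ᵇ_; _≤_; _<_; z≤n; s≤s)
import Data.Nat.Properties as ℕ
open import Data.Nat.Properties using (_≟_)
open import Data.Nat.Combinatorics using (_C_; nCk+nC[k+1]≡[n+1]C[k+1])
open import Data.Rational as ℚ using (ℚ; 0ℚ; 1ℚ; fromℚᵘ)
import Data.Rational.Properties as ℚ
open import Data.Rational.Unnormalised as ℚᵘ using (mkℚᵘ; *≡*)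
import Data.Rational.Unnormalised.Properties as ℚᵘ
open import Data.Vec as Vec using (Vec; []; _∷_; lookup)
open import Function using (_∘_; id)
open import Level using (0ℓ)
open import Relation.Binary.PropositionalEquality
open import Relation.Nullary.Decidable using (does)
open import Relation.Unary using (Pred; Decidable)
open ≡-Reasoning

open import Algebra.Properties.CommutativeSemigroup ℤ.+-commutativeSemigroup
  using () renaming (interchange to +-interchange)
open import Algebra.Properties.CommutativeSemigroup ℤ.*-commutativeSemigroup
  using () renaming (x∙yz≈y∙xz to *-exchange)
open import Algebra.Properties.CommutativeSemigroup
  (CommutativeRing.+-commutativeSemigroup xor-∧-commutativeRing)
  using () renaming (interchange to xor-interchange)
open import Algebra.Properties.CommutativeSemigroup
  (CommutativeMonoid.commutativeSemigroup ℚ.*-1-commutativeMonoid)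
  using () renaming (interchange to *ℚ-interchange; xy∙z≈xz∙y to *ℚ-exchange)

-- Finite sums

𝟙 : Bool → ℤ
𝟙 true  = 1ℤ
𝟙 false = 0ℤ

∑ : {A : Set} → List A → (A → ℤ) → ℤ
∑ xs f = foldr (λ x s → f x + s) 0ℤ xs

infix 5 ∑
syntax ∑ xs (λ x → e) = ∑[ x ∈ xs ] e

module _ {A : Set} where

  ∑-cong : (xs : List A) {f g : A → ℤ} → (∀ x → f x ≡ g x) → ∑ xs f ≡ ∑ xs g
  ∑-cong []       f≗g = refl
  ∑-cong (x ∷ xs) f≗g = cong₂ _+_ (f≗g x) (∑-cong xs f≗g)

  ∑-zero : (xs : List A) → ∑[ _ ∈ xs ] 0ℤ ≡ 0ℤ
  ∑-zero []       = refl
  ∑-zero (x ∷ xs) = cong (_+_ 0ℤ) (∑-zero xs)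

  ∑-+ : (xs : List A) (f g : A → ℤ) → ∑[ x ∈ xs ] (f x + g x) ≡ ∑ xs f + ∑ xs g
  ∑-+ []       f g = refl
  ∑-+ (x ∷ xs) f g = begin
    (f x + g x) + (∑[ x ∈ xs ] f x + g x) ≡⟨ cong (_+_ (f x + g x)) (∑-+ xs f g) ⟩
    (f x + g x) + (∑ xs f + ∑ xs g)       ≡⟨ +-interchange (f x) (g x) (∑ xs f) (∑ xs g) ⟩
    (f x + ∑ xs f) + (g x + ∑ xs g)       ∎

  ∑-*ˡ : (c : ℤ) (xs : List A) (f : A → ℤ) → ∑[ x ∈ xs ] (c * f x) ≡ c * ∑ xs f
  ∑-*ˡ c []       f = sym (ℤ.*-zeroʳ c)
  ∑-*ˡ c (x ∷ xs) f =
    trans (cong (_+_ (c * f x)) (∑-*ˡ c xs f)) (sym (ℤ.*-distribˡ-+ c (f x) (∑ xs f)))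

  ∑-*ʳ : (c : ℤ) (xs : List A) (f : A → ℤ) → ∑[ x ∈ xs ] (f x * c) ≡ ∑ xs f * c
  ∑-*ʳ c xs f = trans (∑-cong xs (λ x → ℤ.*-comm (f x) c)) (trans (∑-*ˡ c xs f) (ℤ.*-comm c (∑ xs f)))

  ∑-++ : (xs ys : List A) (f : A → ℤ) → ∑ (xs ++ ys) f ≡ ∑ xs f + ∑ ys f
  ∑-++ []       ys f = sym (ℤ.+-identityˡ (∑ ys f))
  ∑-++ (x ∷ xs) ys f =
    trans (cong (_+_ (f x)) (∑-++ xs ys f)) (sym (ℤ.+-assoc (f x) (∑ xs f) (∑ ys f)))

  ∑-concatMap : {B : Set} (g : B → List A) (ys : List B) (f : A → ℤ) →
                ∑ (concatMap g ys) f ≡ ∑[ y ∈ ys ] ∑ (g y) f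
  ∑-concatMap g []       f = refl
  ∑-concatMap g (y ∷ ys) f =
    trans (∑-++ (g y) (concatMap g ys) f) (cong (_+_ (∑ (g y) f)) (∑-concatMap g ys f))

  ∑-map : {B : Set} (g : B → A) (ys : List B) (f : A → ℤ) → ∑ (map g ys) f ≡ ∑ ys (f ∘ g)
  ∑-map g []       f = refl
  ∑-map g (y ∷ ys) f = cong (_+_ (f (g y))) (∑-map g ys f)

  ∑-1 : (xs : List A) → ∑[ _ ∈ xs ] 1ℤ ≡ + length xs
  ∑-1 []       = refl
  ∑-1 (x ∷ xs) = trans (cong (_+_ 1ℤ) (∑-1 xs)) (sym (ℤ.pos-+ 1 (length xs)))

  ∑-filter : {P : Pred A 0ℓ} (P? : Decidable P) (xs : List A) (f : A → ℤ) →
             ∑ (filter P? xs) f ≡ ∑[ x ∈ xs ] (𝟙 (does (P? x)) * f x)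
  ∑-filter P? []       f = refl
  ∑-filter P? (x ∷ xs) f with does (P? x)
  ... | true  = cong₂ _+_ (sym (ℤ.*-identityˡ (f x))) (∑-filter P? xs f)
  ... | false = trans (∑-filter P? xs f) (sym (ℤ.+-identityˡ _))

  length-filter : {P : Pred A 0ℓ} (P? : Decidable P) (xs : List A) →
                  + length (filter P? xs) ≡ ∑[ x ∈ xs ] 𝟙 (does (P? x))
  length-filter P? xs = begin
    + length (filter P? xs)           ≡⟨ ∑-1 (filter P? xs) ⟨
    ∑[ _ ∈ filter P? xs ] 1ℤ          ≡⟨ ∑-filter P? xs (λ _ → 1ℤ) ⟩
    ∑[ x ∈ xs ] 𝟙 (does (P? x)) * 1ℤ  ≡⟨ ∑-cong xs (λ x → ℤ.*-identityʳ (𝟙 (does (P? x)))) ⟩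
    ∑[ x ∈ xs ] 𝟙 (does (P? x))       ∎

  pos-∑ : (xs : List A) (f : A → ℕ) → + foldr (λ x s → f x ℕ.+ s) 0 xs ≡ ∑[ x ∈ xs ] + f x
  pos-∑ xs f = foldr-fusion +_ 0 (λ x s → ℤ.pos-+ (f x) s) xs

∑-swap : {A B : Set} (xs : List A) (ys : List B) (f : A → B → ℤ) →
         ∑[ x ∈ xs ] ∑[ y ∈ ys ] f x y ≡ ∑[ y ∈ ys ] ∑[ x ∈ xs ] f x y
∑-swap []       ys f = sym (∑-zero ys)
∑-swap (x ∷ xs) ys f = begin
  ∑ ys (f x) + (∑[ x ∈ xs ] ∑[ y ∈ ys ] f x y)  ≡⟨ cong (_+_ (∑ ys (f x))) (∑-swap xs ys f) ⟩
  ∑ ys (f x) + (∑[ y ∈ ys ] ∑[ x ∈ xs ] f x y)  ≡⟨ ∑-+ ys (f x) _ ⟨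
  ∑[ y ∈ ys ] f x y + (∑[ x ∈ xs ] f x y)       ∎

sumℤ-suc : ∀ N (f : ℕ → ℤ) → sumℤ (suc N) f ≡ f 0 + sumℤ N (f ∘ suc)
sumℤ-suc N f = cong (_+_ (f 0)) (begin
  ∑ (applyUpTo suc (suc N)) f     ≡⟨ cong (λ ms → ∑ ms f) (map-applyUpTo id suc (suc N)) ⟨
  ∑ (map suc (upTo (suc N))) f    ≡⟨ ∑-map suc (upTo (suc N)) f ⟩
  sumℤ N (f ∘ suc)               ∎)

-- Polynomial coefficient sequences and Krawtchouk numbers

-- Sequences ℕ → ℤ are coefficient lists of polynomials: shift multiplies by x and _⊛_ is the
-- product.

shift : (ℕ → ℤ) → ℕ → ℤ
shift f zero    = 0ℤ
shift f (suc k) = f k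

infixl 7 _⊛_

_⊛_ : (ℕ → ℤ) → (ℕ → ℤ) → ℕ → ℤ
(f ⊛ g) zero    = f 0 * g 0
(f ⊛ g) (suc k) = f 0 * g (suc k) + (f ∘ suc ⊛ g) k

shift-cong : ∀ {f g} → (∀ k → f k ≡ g k) → ∀ k → shift f k ≡ shift g k
shift-cong f≗g zero    = refl
shift-cong f≗g (suc k) = f≗g k

⊛-sumℤ : ∀ f g k → (f ⊛ g) k ≡ sumℤ k (λ s → f s * g (k ∸ s))
⊛-sumℤ f g zero    = sym (ℤ.+-identityʳ (f 0 * g 0))
⊛-sumℤ f g (suc k) =
  trans (cong (_+_ (f 0 * g (suc k))) (⊛-sumℤ (f ∘ suc) g k)) (sym (sumℤ-suc k (λ s → f s * g (suc k ∸ s))))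

⊛-cong : ∀ {f f′ g g′} → (∀ s → f s ≡ f′ s) → (∀ t → g t ≡ g′ t) → ∀ k → (f ⊛ g) k ≡ (f′ ⊛ g′) k
⊛-cong f≗f′ g≗g′ zero    = cong₂ _*_ (f≗f′ 0) (g≗g′ 0)
⊛-cong f≗f′ g≗g′ (suc k) =
  cong₂ _+_ (cong₂ _*_ (f≗f′ 0) (g≗g′ (suc k))) (⊛-cong (f≗f′ ∘ suc) g≗g′ k)

⊛-zeroˡ : ∀ g k → ((λ _ → 0ℤ) ⊛ g) k ≡ 0ℤ
⊛-zeroˡ g zero    = refl
⊛-zeroˡ g (suc k) = cong (_+_ 0ℤ) (⊛-zeroˡ g k)

⊛-shiftˡ : ∀ f g k → (shift f ⊛ g) k ≡ shift (f ⊛ g) k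
⊛-shiftˡ f g zero    = refl
⊛-shiftˡ f g (suc k) = ℤ.+-identityˡ ((f ⊛ g) k)

⊛-shiftʳ : ∀ f g k → (f ⊛ shift g) k ≡ shift (f ⊛ g) k
⊛-shiftʳ f g zero    = ℤ.*-zeroʳ (f 0)
⊛-shiftʳ f g (suc k) = trans (cong (_+_ (f 0 * g k)) (⊛-shiftʳ (f ∘ suc) g k)) (unfold k)
  where
  unfold : ∀ k → f 0 * g k + shift (f ∘ suc ⊛ g) k ≡ (f ⊛ g) k
  unfold zero    = ℤ.+-identityʳ (f 0 * g 0)
  unfold (suc k) = refl

⊛-distribˡ-+ : ∀ f g h k → (f ⊛ (λ t → g t + h t)) k ≡ (f ⊛ g) k + (f ⊛ h) k
⊛-distribˡ-+ f g h zero    = ℤ.*-distribˡ-+ (f 0) (g 0) (h 0)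
⊛-distribˡ-+ f g h (suc k) = begin
  f 0 * (g (suc k) + h (suc k)) + (f ∘ suc ⊛ (λ t → g t + h t)) k
    ≡⟨ cong₂ _+_ (ℤ.*-distribˡ-+ (f 0) (g (suc k)) (h (suc k))) (⊛-distribˡ-+ (f ∘ suc) g h k) ⟩
  (f 0 * g (suc k) + f 0 * h (suc k)) + ((f ∘ suc ⊛ g) k + (f ∘ suc ⊛ h) k)
    ≡⟨ +-interchange (f 0 * g (suc k)) (f 0 * h (suc k)) _ _ ⟩
  (f ⊛ g) (suc k) + (f ⊛ h) (suc k) ∎

⊛-distribʳ-sub : ∀ f g h k → ((λ s → f s - g s) ⊛ h) k ≡ (f ⊛ h) k - (g ⊛ h) k
⊛-distribʳ-sub f g h zero    =
  trans (ℤ.*-distribʳ-+ (h 0) (f 0) (- g 0)) (cong (_+_ (f 0 * h 0)) (sym (ℤ.neg-distribˡ-* (g 0) (h 0))))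
⊛-distribʳ-sub f g h (suc k) =
  trans (cong (_+_ ((f 0 - g 0) * h (suc k))) (⊛-distribʳ-sub (f ∘ suc) (g ∘ suc) h k))
        (regroup (f 0) (g 0) (h (suc k)) ((f ∘ suc ⊛ h) k) ((g ∘ suc ⊛ h) k))
  where
  regroup : ∀ a b c x y → (a - b) * c + (x - y) ≡ (a * c + x) - (b * c + y)
  regroup = solve-∀

binom : ℕ → ℕ → ℤ
binom n k = + (n C k)

pascal : ∀ n k → binom (suc n) (suc k) ≡ binom n k + binom n (suc k)
pascal n k = trans (cong +_ (sym (nCk+nC[k+1]≡[n+1]C[k+1] n k))) (ℤ.pos-+ (n C k) (n C suc k))

altBinom : ℕ → ℕ → ℤ
altBinom a s = sign s * + (a C s)

binom-suc : ∀ b t → binom (suc b) t ≡ binom b t + shift (binom b) t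
binom-suc b zero    = refl
binom-suc b (suc t) = trans (pascal b t) (ℤ.+-comm (binom b t) (binom b (suc t)))

altBinom-suc : ∀ a s → altBinom (suc a) s ≡ altBinom a s - shift (altBinom a) s
altBinom-suc a zero    = refl
altBinom-suc a (suc s) =
  trans (cong (sign (suc s) *_) (pascal a s)) (expand (sign s) (+ (a C s)) (+ (a C suc s)))
  where
  expand : ∀ σ x y → - σ * (x + y) ≡ - σ * y - σ * x
  expand = solve-∀

-- The coefficient of xᵏ in (1 - x)ᵃ (1 + x)ᵇ.

krawtchouk : ℕ → ℕ → ℕ → ℤ
krawtchouk a b = altBinom a ⊛ binom b

ω≡krawtchouk : ∀ n m k → ω n m k ≡ krawtchouk m (n ∸ m) k
ω≡krawtchouk n m k = sym (trans (⊛-sumℤ (altBinom m) (binom (n ∸ m)) k)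
  (∑-cong (upTo (suc k)) λ s →
    trans (ℤ.*-assoc (sign s) (+ (m C s)) (+ ((n ∸ m) C (k ∸ s))))
          (cong (sign s *_) (sym (ℤ.pos-* (m C s) ((n ∸ m) C (k ∸ s)))))))

krawtchouk-zeroˡ : ∀ b k → krawtchouk 0 b k ≡ binom b k
krawtchouk-zeroˡ b zero    = refl
krawtchouk-zeroˡ b (suc k) = begin
  1ℤ * binom b (suc k) + (altBinom 0 ∘ suc ⊛ binom b) k
    ≡⟨ cong₂ _+_ (ℤ.*-identityˡ (binom b (suc k)))
                 (⊛-cong {g = binom b} (λ s → ℤ.*-zeroʳ (sign (suc s))) (λ _ → refl) k) ⟩
  binom b (suc k) + ((λ _ → 0ℤ) ⊛ binom b) k
    ≡⟨ cong (_+_ (binom b (suc k))) (⊛-zeroˡ (binom b) k) ⟩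
  binom b (suc k) + 0ℤ
    ≡⟨ ℤ.+-identityʳ _ ⟩
  binom b (suc k) ∎

krawtchouk-sucʳ : ∀ a b k → krawtchouk a (suc b) k ≡ krawtchouk a b k + shift (krawtchouk a b) k
krawtchouk-sucʳ a b k = begin
  (altBinom a ⊛ binom (suc b)) k
    ≡⟨ ⊛-cong (λ _ → refl) (binom-suc b) k ⟩
  (altBinom a ⊛ (λ t → binom b t + shift (binom b) t)) k
    ≡⟨ ⊛-distribˡ-+ (altBinom a) (binom b) (shift (binom b)) k ⟩
  krawtchouk a b k + (altBinom a ⊛ shift (binom b)) k
    ≡⟨ cong (_+_ (krawtchouk a b k)) (⊛-shiftʳ (altBinom a) (binom b) k) ⟩
  krawtchouk a b k + shift (krawtchouk a b) k ∎

krawtchouk-sucˡ : ∀ a b k → krawtchouk (suc a) b k ≡ krawtchouk a b k - shift (krawtchouk a b) k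
krawtchouk-sucˡ a b k = begin
  (altBinom (suc a) ⊛ binom b) k
    ≡⟨ ⊛-cong (altBinom-suc a) (λ _ → refl) k ⟩
  ((λ s → altBinom a s - shift (altBinom a) s) ⊛ binom b) k
    ≡⟨ ⊛-distribʳ-sub (altBinom a) (shift (altBinom a)) (binom b) k ⟩
  krawtchouk a b k - (shift (altBinom a) ⊛ binom b) k
    ≡⟨ cong (λ z → krawtchouk a b k - z) (⊛-shiftˡ (altBinom a) (binom b) k) ⟩
  krawtchouk a b k - shift (krawtchouk a b) k ∎

-- Characters of GF(2)ⁿ

χ : Bool → ℤ
χ false = 1ℤ
χ true  = -1ℤ

χ-xor : ∀ a b → χ (a xor b) ≡ χ a * χ b
χ-xor false false = refl
χ-xor false true  = refl
χ-xor true  false = refl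
χ-xor true  true  = refl

infix 8 _·_

_·_ : ∀ {n} → Vec Bool n → (Fin n → Bool) → Bool
[]      · g = false
(c ∷ u) · g = (c ∧ g zero) xor (u · (g ∘ suc))

·-xor : ∀ {n} (u : Vec Bool n) g h → u · (λ j → g j xor h j) ≡ (u · g) xor (u · h)
·-xor []      g h = refl
·-xor (c ∷ u) g h = trans
  (cong₂ _xor_ (∧-distribˡ-xor c (g zero) (h zero)) (·-xor u (g ∘ suc) (h ∘ suc)))
  (xor-interchange (c ∧ g zero) (c ∧ h zero) (u · (g ∘ suc)) (u · (h ∘ suc)))

·-∧ʳ : ∀ {n} (u : Vec Bool n) g b → u · (λ j → g j ∧ b) ≡ (u · g) ∧ b
·-∧ʳ []      g b = refl
·-∧ʳ (c ∷ u) g b = trans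
  (cong₂ _xor_ (sym (∧-assoc c (g zero) b)) (·-∧ʳ u (g ∘ suc) b))
  (sym (∧-distribʳ-xor b (c ∧ g zero) (u · (g ∘ suc))))

·-zeroʳ : ∀ {n} (u : Vec Bool n) → u · (λ _ → false) ≡ false
·-zeroʳ []      = refl
·-zeroʳ (c ∷ u) = cong₂ _xor_ (∧-zeroʳ c) (·-zeroʳ u)

·-zeroˡ : ∀ n g → Vec.replicate n false · g ≡ false
·-zeroˡ zero    g = refl
·-zeroˡ (suc n) g = ·-zeroˡ n (g ∘ suc)

∑-allVecs-suc : ∀ n (f : Vec Bool (suc n) → ℤ) →
                ∑ (allVecs (suc n)) f ≡ ∑[ v ∈ allVecs n ] f (false ∷ v) + f (true ∷ v)
∑-allVecs-suc n f = trans (∑-concatMap (λ v → (false ∷ v) ∷ (true ∷ v) ∷ []) (allVecs n) f)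
  (∑-cong (allVecs n) λ v → cong (_+_ (f (false ∷ v))) (ℤ.+-identityʳ (f (true ∷ v))))

-- For n = suc _, isZero g reduces to does (g zero ≟𝔹 false) ∧ isZero (g ∘ suc).

isZero : ∀ {n} → (Fin n → Bool) → Bool
isZero g = does (all? (λ j → g j ≟𝔹 false))

∑-χ-· : ∀ n (g : Fin n → Bool) → ∑[ u ∈ allVecs n ] χ (u · g) ≡ + (2 ℕ.^ n) * 𝟙 (isZero g)
∑-χ-· zero    g = refl
∑-χ-· (suc n) g = begin
  ∑[ u ∈ allVecs (suc n) ] χ (u · g)
    ≡⟨ ∑-allVecs-suc n (λ u → χ (u · g)) ⟩
  ∑[ v ∈ allVecs n ] χ (v · g′) + χ (g zero xor v · g′)
    ≡⟨ ∑-cong (allVecs n) factor ⟩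
  ∑[ v ∈ allVecs n ] (1ℤ + χ (g zero)) * χ (v · g′)
    ≡⟨ ∑-*ˡ (1ℤ + χ (g zero)) (allVecs n) (λ v → χ (v · g′)) ⟩
  (1ℤ + χ (g zero)) * (∑[ v ∈ allVecs n ] χ (v · g′))
    ≡⟨ cong (_*_ (1ℤ + χ (g zero))) (∑-χ-· n g′) ⟩
  (1ℤ + χ (g zero)) * (+ (2 ℕ.^ n) * 𝟙 (isZero g′))
    ≡⟨ double (g zero) ⟩
  + (2 ℕ.^ suc n) * 𝟙 (isZero g) ∎
  where
  g′ = g ∘ suc
  factor : ∀ v → χ (v · g′) + χ (g zero xor v · g′) ≡ (1ℤ + χ (g zero)) * χ (v · g′)
  factor v = begin
    χ (v · g′) + χ (g zero xor v · g′)        ≡⟨ cong (_+_ (χ (v · g′))) (χ-xor (g zero) (v · g′)) ⟩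
    χ (v · g′) + χ (g zero) * χ (v · g′)      ≡⟨ cong (_+ χ (g zero) * χ (v · g′)) (ℤ.*-identityˡ (χ (v · g′))) ⟨
    1ℤ * χ (v · g′) + χ (g zero) * χ (v · g′) ≡⟨ ℤ.*-distribʳ-+ (χ (v · g′)) 1ℤ (χ (g zero)) ⟨
    (1ℤ + χ (g zero)) * χ (v · g′)            ∎
  double : ∀ b → (1ℤ + χ b) * (+ (2 ℕ.^ n) * 𝟙 (isZero g′))
                 ≡ + (2 ℕ.^ suc n) * 𝟙 (does (b ≟𝔹 false) ∧ isZero g′)
  double false = trans (sym (ℤ.*-assoc (+ 2) (+ (2 ℕ.^ n)) _))
                       (cong (_* 𝟙 (isZero g′)) (sym (ℤ.pos-* 2 (2 ℕ.^ n))))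
  double true  = sym (ℤ.*-zeroʳ (+ (2 ℕ.^ suc n)))

weightSum : ∀ {n} → Vec Bool n → ℕ → ℤ
weightSum {n} u k = ∑[ r ∈ allVecs n ] 𝟙 (ones r ≡ᵇ k) * χ (u · lookup r)

weightSum-∷ : ∀ {n} c (u : Vec Bool n) k →
              weightSum (c ∷ u) k ≡ weightSum u k + χ c * shift (weightSum u) k
weightSum-∷ {n} c u k = begin
  weightSum (c ∷ u) k
    ≡⟨ ∑-allVecs-suc n (λ r → 𝟙 (ones r ≡ᵇ k) * χ ((c ∷ u) · lookup r)) ⟩
  ∑[ v ∈ allVecs n ] 𝟙 (ones v ≡ᵇ k) * χ ((c ∷ u) · lookup (false ∷ v))
                     + 𝟙 (suc (ones v) ≡ᵇ k) * χ ((c ∷ u) · lookup (true ∷ v))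
    ≡⟨ ∑-cong (allVecs n) (split c) ⟩
  ∑[ v ∈ allVecs n ] 𝟙 (ones v ≡ᵇ k) * χ (u · lookup v) + χ c * shifted v
    ≡⟨ ∑-+ (allVecs n) (λ v → 𝟙 (ones v ≡ᵇ k) * χ (u · lookup v)) (λ v → χ c * shifted v) ⟩
  weightSum u k + (∑[ v ∈ allVecs n ] χ c * shifted v)
    ≡⟨ cong (_+_ (weightSum u k)) (∑-*ˡ (χ c) (allVecs n) shifted) ⟩
  weightSum u k + χ c * ∑ (allVecs n) shifted
    ≡⟨ cong (λ s → weightSum u k + χ c * s) (∑-shifted k) ⟩
  weightSum u k + χ c * shift (weightSum u) k ∎
  where
  shifted : Vec Bool n → ℤ
  shifted v = 𝟙 (suc (ones v) ≡ᵇ k) * χ (u · lookup v)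

  split : ∀ b v → 𝟙 (ones v ≡ᵇ k) * χ ((b ∷ u) · lookup (false ∷ v))
                  + 𝟙 (suc (ones v) ≡ᵇ k) * χ ((b ∷ u) · lookup (true ∷ v))
                ≡ 𝟙 (ones v ≡ᵇ k) * χ (u · lookup v) + χ b * shifted v
  split false v = cong (_+_ (𝟙 (ones v ≡ᵇ k) * χ (u · lookup v))) (sym (ℤ.*-identityˡ (shifted v)))
  split true  v = cong (_+_ (𝟙 (ones v ≡ᵇ k) * χ (u · lookup v)))
    (trans (cong (𝟙 (suc (ones v) ≡ᵇ k) *_) (χ-xor true (u · lookup v)))
           (*-exchange (𝟙 (suc (ones v) ≡ᵇ k)) -1ℤ (χ (u · lookup v))))

  ∑-shifted : ∀ j → ∑[ v ∈ allVecs n ] 𝟙 (suc (ones v) ≡ᵇ j) * χ (u · lookup v) ≡ shift (weightSum u) j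
  ∑-shifted zero    = ∑-zero (allVecs n)
  ∑-shifted (suc j) = refl

ones-≤ : ∀ {n} (u : Vec Bool n) → ones u ≤ n
ones-≤ []          = z≤n
ones-≤ (true ∷ u)  = s≤s (ones-≤ u)
ones-≤ (false ∷ u) = ℕ.m≤n⇒m≤1+n (ones-≤ u)

-- Peeling off the first coordinate multiplies both sides by 1 + x or 1 - x.

weightSum≡krawtchouk : ∀ {n} (u : Vec Bool n) k → weightSum u k ≡ krawtchouk (ones u) (n ∸ ones u) k
weightSum≡krawtchouk []          zero    = refl
weightSum≡krawtchouk []          (suc k) = sym (krawtchouk-zeroˡ 0 (suc k))
weightSum≡krawtchouk {suc n} (false ∷ u) k = begin
  weightSum (false ∷ u) k
    ≡⟨ weightSum-∷ false u k ⟩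
  weightSum u k + 1ℤ * shift (weightSum u) k
    ≡⟨ cong₂ _+_ (weightSum≡krawtchouk u k)
                 (trans (ℤ.*-identityˡ _) (shift-cong (weightSum≡krawtchouk u) k)) ⟩
  krawtchouk m (n ∸ m) k + shift (krawtchouk m (n ∸ m)) k
    ≡⟨ krawtchouk-sucʳ m (n ∸ m) k ⟨
  krawtchouk m (suc (n ∸ m)) k
    ≡⟨ cong (λ b → krawtchouk m b k) (ℕ.+-∸-assoc 1 (ones-≤ u)) ⟨
  krawtchouk m (suc n ∸ m) k ∎
  where m = ones u
weightSum≡krawtchouk {suc n} (true ∷ u) k = begin
  weightSum (true ∷ u) k
    ≡⟨ weightSum-∷ true u k ⟩
  weightSum u k + -1ℤ * shift (weightSum u) k
    ≡⟨ cong₂ _+_ (weightSum≡krawtchouk u k)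
                 (trans (ℤ.-1*i≡-i _) (cong -_ (shift-cong (weightSum≡krawtchouk u) k))) ⟩
  krawtchouk m (n ∸ m) k - shift (krawtchouk m (n ∸ m)) k
    ≡⟨ krawtchouk-sucˡ m (n ∸ m) k ⟨
  krawtchouk (suc m) (n ∸ m) k ∎
  where m = ones u

-- Allowing any bound N ≥ n lets the step use the hypothesis at bounds N and N - 1 without
-- reindexing; the terms with m > n vanish because C(n, m) = 0.

∑-by-weight : ∀ {n N} → n ≤ N → (G : ℕ → ℤ) →
              ∑[ u ∈ allVecs n ] G (ones u) ≡ sumℤ N (λ m → binom n m * G m)
∑-by-weight {zero} {zero}  _ G = cong (_+ 0ℤ) (sym (ℤ.*-identityˡ (G 0)))
∑-by-weight {zero} {suc N} _ G = begin
  G 0 + 0ℤ                             ≡⟨ cong₂ _+_ (ℤ.*-identityˡ (G 0)) (∑-zero (upTo (suc N))) ⟨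
  1ℤ * G 0 + sumℤ N (λ _ → 0ℤ)         ≡⟨ sumℤ-suc N (λ m → binom 0 m * G m) ⟨
  sumℤ (suc N) (λ m → binom 0 m * G m) ∎
∑-by-weight {suc n} {suc N} (s≤s n≤N) G = begin
  ∑[ u ∈ allVecs (suc n) ] G (ones u)
    ≡⟨ ∑-allVecs-suc n (G ∘ ones) ⟩
  ∑[ v ∈ allVecs n ] G (ones v) + G (suc (ones v))
    ≡⟨ ∑-+ (allVecs n) (G ∘ ones) (G ∘ suc ∘ ones) ⟩
  (∑[ v ∈ allVecs n ] G (ones v)) + (∑[ v ∈ allVecs n ] G (suc (ones v)))
    ≡⟨ cong₂ _+_ (∑-by-weight (ℕ.m≤n⇒m≤1+n n≤N) G) (∑-by-weight n≤N (G ∘ suc)) ⟩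
  sumℤ (suc N) (λ m → binom n m * G m) + sumℤ N (λ m → binom n m * G (suc m))
    ≡⟨ cong (_+ sumℤ N (λ m → binom n m * G (suc m))) (sumℤ-suc N (λ m → binom n m * G m)) ⟩
  (1ℤ * G 0 + sumℤ N (λ m → binom n (suc m) * G (suc m))) + sumℤ N (λ m → binom n m * G (suc m))
    ≡⟨ ℤ.+-assoc (1ℤ * G 0) _ _ ⟩
  1ℤ * G 0 + (sumℤ N (λ m → binom n (suc m) * G (suc m)) + sumℤ N (λ m → binom n m * G (suc m)))
    ≡⟨ cong (_+_ (1ℤ * G 0)) (∑-+ (upTo (suc N)) (λ m → binom n (suc m) * G (suc m))
                                                  (λ m → binom n m * G (suc m))) ⟨
  1ℤ * G 0 + sumℤ N (λ m → binom n (suc m) * G (suc m) + binom n m * G (suc m))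
    ≡⟨ cong (_+_ (1ℤ * G 0)) (∑-cong (upTo (suc N)) collect) ⟩
  1ℤ * G 0 + sumℤ N (λ m → binom (suc n) (suc m) * G (suc m))
    ≡⟨ sumℤ-suc N (λ m → binom (suc n) m * G m) ⟨
  sumℤ (suc N) (λ m → binom (suc n) m * G m) ∎
  where
  collect : ∀ m → binom n (suc m) * G (suc m) + binom n m * G (suc m) ≡ binom (suc n) (suc m) * G (suc m)
  collect m = trans (sym (ℤ.*-distribʳ-+ (G (suc m)) (binom n (suc m)) (binom n m)))
                    (cong (_* G (suc m)) (trans (ℤ.+-comm (binom n (suc m)) (binom n m)) (sym (pascal n m))))

vecsOfWeight : (n k : ℕ) → List (Vec Bool n)
vecsOfWeight n k = filter (λ r → ones r ≟ k) (allVecs n)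

∑-vecsOfWeight : ∀ n k (f : Vec Bool n → ℤ) →
                 ∑ (vecsOfWeight n k) f ≡ ∑[ r ∈ allVecs n ] 𝟙 (ones r ≡ᵇ k) * f r
∑-vecsOfWeight n k = ∑-filter (λ r → ones r ≟ k) (allVecs n)

ones-replicate : ∀ n → ones (Vec.replicate n false) ≡ 0
ones-replicate zero    = refl
ones-replicate (suc n) = ones-replicate n

-- Counted as weightSum at the zero vector.

length-vecsOfWeight : ∀ n k → length (vecsOfWeight n k) ≡ n C k
length-vecsOfWeight n k = ℤ.+-injective (begin
  + length (vecsOfWeight n k)
    ≡⟨ ∑-1 (vecsOfWeight n k) ⟨
  ∑[ _ ∈ vecsOfWeight n k ] 1ℤ
    ≡⟨ ∑-vecsOfWeight n k (λ _ → 1ℤ) ⟩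
  ∑[ r ∈ allVecs n ] 𝟙 (ones r ≡ᵇ k) * 1ℤ
    ≡⟨ ∑-cong (allVecs n) (λ r → cong (λ b → 𝟙 (ones r ≡ᵇ k) * χ b) (·-zeroˡ n (lookup r))) ⟨
  weightSum 0ᵥ k
    ≡⟨ weightSum≡krawtchouk 0ᵥ k ⟩
  krawtchouk (ones 0ᵥ) (n ∸ ones 0ᵥ) k
    ≡⟨ cong (λ m → krawtchouk m (n ∸ m) k) (ones-replicate n) ⟩
  krawtchouk 0 n k
    ≡⟨ krawtchouk-zeroˡ n k ⟩
  + (n C k) ∎)
  where 0ᵥ = Vec.replicate n false

∑-vecsOfWeight-1+χ : ∀ {n} k (u : Vec Bool n) →
                     ∑[ r ∈ vecsOfWeight n k ] 1ℤ + χ (u · lookup r) ≡ + (n C k) + ω n (ones u) k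
∑-vecsOfWeight-1+χ {n} k u = begin
  ∑[ r ∈ vecsOfWeight n k ] 1ℤ + χ (u · lookup r)
    ≡⟨ ∑-+ (vecsOfWeight n k) (λ _ → 1ℤ) (λ r → χ (u · lookup r)) ⟩
  (∑[ _ ∈ vecsOfWeight n k ] 1ℤ) + (∑[ r ∈ vecsOfWeight n k ] χ (u · lookup r))
    ≡⟨ cong₂ _+_ (trans (∑-1 (vecsOfWeight n k)) (cong +_ (length-vecsOfWeight n k)))
                 (∑-vecsOfWeight n k (λ r → χ (u · lookup r))) ⟩
  + (n C k) + weightSum u k
    ≡⟨ cong (_+_ (+ (n C k))) (trans (weightSum≡krawtchouk u k) (sym (ω≡krawtchouk n (ones u) k))) ⟩
  + (n C k) + ω n (ones u) k ∎

-- Counting kernel vectors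

∏ : {A : Set} {L : ℕ} → Vec A L → (A → ℤ) → ℤ
∏ []      h = 1ℤ
∏ (r ∷ B) h = h r * ∏ B h

∑-tuples-∏ : {A : Set} (L : ℕ) (R : List A) (h : A → ℤ) → ∑[ B ∈ tuples L R ] ∏ B h ≡ ∑ R h ^ L
∑-tuples-∏ zero    R h = refl
∑-tuples-∏ (suc L) R h = begin
  ∑ (concatMap (λ r → map (r ∷_) (tuples L R)) R) (λ B → ∏ B h)
    ≡⟨ ∑-concatMap (λ r → map (r ∷_) (tuples L R)) R (λ B → ∏ B h) ⟩
  ∑[ r ∈ R ] ∑ (map (r ∷_) (tuples L R)) (λ B → ∏ B h)
    ≡⟨ ∑-cong R (λ r → ∑-map (r ∷_) (tuples L R) (λ B → ∏ B h)) ⟩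
  ∑[ r ∈ R ] ∑[ B ∈ tuples L R ] h r * ∏ B h
    ≡⟨ ∑-cong R (λ r → ∑-*ˡ (h r) (tuples L R) (λ B → ∏ B h)) ⟩
  ∑[ r ∈ R ] h r * (∑[ B ∈ tuples L R ] ∏ B h)
    ≡⟨ ∑-cong R (λ r → cong (h r *_) (∑-tuples-∏ L R h)) ⟩
  ∑[ r ∈ R ] h r * ∑ R h ^ L
    ≡⟨ ∑-*ʳ (∑ R h ^ L) R h ⟩
  ∑ R h * ∑ R h ^ L ∎

∑-χ-ATx : ∀ {L n} (u : Vec Bool n) (A : Matrix L n) →
          ∑[ x ∈ allVecs L ] χ (u · ATx A x) ≡ ∏ A (λ r → 1ℤ + χ (u · lookup r))
∑-χ-ATx u []      = cong (λ b → χ b + 0ℤ) (·-zeroʳ u)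
∑-χ-ATx u (r ∷ A) = begin
  ∑[ x ∈ allVecs _ ] χ (u · ATx (r ∷ A) x)
    ≡⟨ ∑-allVecs-suc _ (λ x → χ (u · ATx (r ∷ A) x)) ⟩
  ∑[ y ∈ allVecs _ ] χ (u · ATx (r ∷ A) (false ∷ y)) + χ (u · ATx (r ∷ A) (true ∷ y))
    ≡⟨ ∑-cong (allVecs _) (λ y → trans (cong₂ _+_ (peel false y) (peel true y))
                                        (sum-over-bit (u · lookup r) (χ (u · ATx A y)))) ⟩
  ∑[ y ∈ allVecs _ ] (1ℤ + χ (u · lookup r)) * χ (u · ATx A y)
    ≡⟨ ∑-*ˡ (1ℤ + χ (u · lookup r)) (allVecs _) (λ y → χ (u · ATx A y)) ⟩
  (1ℤ + χ (u · lookup r)) * (∑[ y ∈ allVecs _ ] χ (u · ATx A y))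
    ≡⟨ cong (_*_ (1ℤ + χ (u · lookup r))) (∑-χ-ATx u A) ⟩
  (1ℤ + χ (u · lookup r)) * ∏ A (λ r → 1ℤ + χ (u · lookup r)) ∎
  where
  peel : ∀ b y → χ (u · ATx (r ∷ A) (b ∷ y)) ≡ χ ((u · lookup r) ∧ b) * χ (u · ATx A y)
  peel b y = begin
    χ (u · (λ j → (lookup r j ∧ b) xor ATx A y j))
      ≡⟨ cong χ (·-xor u (λ j → lookup r j ∧ b) (ATx A y)) ⟩
    χ (u · (λ j → lookup r j ∧ b) xor u · ATx A y)
      ≡⟨ cong (λ d → χ (d xor u · ATx A y)) (·-∧ʳ u (lookup r) b) ⟩
    χ ((u · lookup r) ∧ b xor u · ATx A y)
      ≡⟨ χ-xor ((u · lookup r) ∧ b) (u · ATx A y) ⟩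
    χ ((u · lookup r) ∧ b) * χ (u · ATx A y) ∎
  sum-over-bit : ∀ d x → χ (d ∧ false) * x + χ (d ∧ true) * x ≡ (1ℤ + χ d) * x
  sum-over-bit d x = trans (sym (ℤ.*-distribʳ-+ x (χ (d ∧ false)) (χ (d ∧ true))))
                         (cong (_* x) (cong₂ (λ p q → χ p + χ q) (∧-zeroʳ d) (∧-identityʳ d)))

Y-fourier : ∀ {L n} (A : Matrix L n) →
            + (2 ℕ.^ n) * + Y A ≡ ∑[ u ∈ allVecs n ] ∏ A (λ r → 1ℤ + χ (u · lookup r))
Y-fourier {L} {n} A = begin
  + (2 ℕ.^ n) * + Y A
    ≡⟨ cong (_*_ (+ (2 ℕ.^ n))) (length-filter (λ x → all? (λ j → ATx A x j ≟𝔹 false)) (allVecs L)) ⟩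
  + (2 ℕ.^ n) * (∑[ x ∈ allVecs L ] 𝟙 (isZero (ATx A x)))
    ≡⟨ ∑-*ˡ (+ (2 ℕ.^ n)) (allVecs L) (λ x → 𝟙 (isZero (ATx A x))) ⟨
  ∑[ x ∈ allVecs L ] + (2 ℕ.^ n) * 𝟙 (isZero (ATx A x))
    ≡⟨ ∑-cong (allVecs L) (λ x → ∑-χ-· n (ATx A x)) ⟨
  ∑[ x ∈ allVecs L ] ∑[ u ∈ allVecs n ] χ (u · ATx A x)
    ≡⟨ ∑-swap (allVecs L) (allVecs n) (λ x u → χ (u · ATx A x)) ⟩
  ∑[ u ∈ allVecs n ] ∑[ x ∈ allVecs L ] χ (u · ATx A x)
    ≡⟨ ∑-cong (allVecs n) (λ u → ∑-χ-ATx u A) ⟩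
  ∑[ u ∈ allVecs n ] ∏ A (λ r → 1ℤ + χ (u · lookup r)) ∎

kernel-count : ∀ L n k → + (2 ℕ.^ n) * + foldr (λ A s → Y A ℕ.+ s) 0 (M L n k)
                         ≡ sumℤ n (λ m → binom n m * (+ (n C k) + ω n m k) ^ L)
kernel-count L n k = begin
  + (2 ℕ.^ n) * + foldr (λ A s → Y A ℕ.+ s) 0 (M L n k)
    ≡⟨ cong (_*_ (+ (2 ℕ.^ n))) (pos-∑ (M L n k) Y) ⟩
  + (2 ℕ.^ n) * (∑[ A ∈ M L n k ] + Y A)
    ≡⟨ ∑-*ˡ (+ (2 ℕ.^ n)) (M L n k) (λ A → + Y A) ⟨
  ∑[ A ∈ M L n k ] + (2 ℕ.^ n) * + Y A
    ≡⟨ ∑-cong (M L n k) Y-fourier ⟩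
  ∑[ A ∈ M L n k ] ∑[ u ∈ allVecs n ] ∏ A (h u)
    ≡⟨ ∑-swap (M L n k) (allVecs n) (λ A u → ∏ A (h u)) ⟩
  ∑[ u ∈ allVecs n ] ∑[ A ∈ M L n k ] ∏ A (h u)
    ≡⟨ ∑-cong (allVecs n) (λ u → ∑-tuples-∏ L (vecsOfWeight n k) (h u)) ⟩
  ∑[ u ∈ allVecs n ] ∑ (vecsOfWeight n k) (h u) ^ L
    ≡⟨ ∑-cong (allVecs n) (λ u → cong (_^ L) (∑-vecsOfWeight-1+χ k u)) ⟩
  ∑[ u ∈ allVecs n ] (+ (n C k) + ω n (ones u) k) ^ L
    ≡⟨ ∑-by-weight (ℕ.≤-refl {n}) (λ m → (+ (n C k) + ω n m k) ^ L) ⟩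
  sumℤ n (λ m → binom n m * (+ (n C k) + ω n m k) ^ L) ∎
  where
  h : Vec Bool n → Vec Bool n → ℤ
  h u r = 1ℤ + χ (u · lookup r)

∏-const-1 : {A : Set} {L : ℕ} (B : Vec A L) → ∏ B (λ _ → 1ℤ) ≡ 1ℤ
∏-const-1 []      = refl
∏-const-1 (r ∷ B) = cong (1ℤ *_) (∏-const-1 B)

pos-^ : ∀ m L → + (m ℕ.^ L) ≡ (+ m) ^ L
pos-^ m zero    = refl
pos-^ m (suc L) = trans (ℤ.pos-* m (m ℕ.^ L)) (cong (+ m *_) (pos-^ m L))

length-M : ∀ L n k → length (M L n k) ≡ (n C k) ℕ.^ L
length-M L n k = ℤ.+-injective (begin
  + length (M L n k)                  ≡⟨ ∑-1 (M L n k) ⟨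
  ∑[ _ ∈ M L n k ] 1ℤ                 ≡⟨ ∑-cong (M L n k) ∏-const-1 ⟨
  ∑[ A ∈ M L n k ] ∏ A (λ _ → 1ℤ)     ≡⟨ ∑-tuples-∏ L (vecsOfWeight n k) (λ _ → 1ℤ) ⟩
  (∑[ _ ∈ vecsOfWeight n k ] 1ℤ) ^ L  ≡⟨ cong (_^ L) (∑-1 (vecsOfWeight n k)) ⟩
  (+ length (vecsOfWeight n k)) ^ L   ≡⟨ cong (λ c → (+ c) ^ L) (length-vecsOfWeight n k) ⟩
  (+ (n C k)) ^ L                     ≡⟨ pos-^ (n C k) L ⟨
  + ((n C k) ℕ.^ L)                   ∎)

-- Passing to ℚ

fromℚᵘ-+ : ∀ p q → fromℚᵘ (p ℚᵘ.+ q) ≡ fromℚᵘ p ℚ.+ fromℚᵘ q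
fromℚᵘ-+ p q = ℚ.toℚᵘ-injective (ℚᵘ.≃-trans (ℚ.toℚᵘ-fromℚᵘ (p ℚᵘ.+ q)) (ℚᵘ.≃-sym
  (ℚᵘ.≃-trans (ℚ.toℚᵘ-homo-+ (fromℚᵘ p) (fromℚᵘ q))
              (ℚᵘ.+-cong (ℚ.toℚᵘ-fromℚᵘ p) (ℚ.toℚᵘ-fromℚᵘ q)))))

fromℚᵘ-* : ∀ p q → fromℚᵘ (p ℚᵘ.* q) ≡ fromℚᵘ p ℚ.* fromℚᵘ q
fromℚᵘ-* p q = ℚ.toℚᵘ-injective (ℚᵘ.≃-trans (ℚ.toℚᵘ-fromℚᵘ (p ℚᵘ.* q)) (ℚᵘ.≃-sym
  (ℚᵘ.≃-trans (ℚ.toℚᵘ-homo-* (fromℚᵘ p) (fromℚᵘ q))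
              (ℚᵘ.*-cong (ℚ.toℚᵘ-fromℚᵘ p) (ℚ.toℚᵘ-fromℚᵘ q)))))

ι : ℤ → ℚ
ι a = divℚ a 1

ι-+ : ∀ a b → ι (a + b) ≡ ι a ℚ.+ ι b
ι-+ a b = trans (ℚ.fromℚᵘ-cong {mkℚᵘ (a + b) 0} {mkℚᵘ a 0 ℚᵘ.+ mkℚᵘ b 0} (*≡* (cross a b)))
                (fromℚᵘ-+ (mkℚᵘ a 0) (mkℚᵘ b 0))
  where
  cross : ∀ a b → (a + b) * 1ℤ ≡ (a * 1ℤ + b * 1ℤ) * 1ℤ
  cross = solve-∀

ι-* : ∀ a b → ι (a * b) ≡ ι a ℚ.* ι b
ι-* a b = fromℚᵘ-* (mkℚᵘ a 0) (mkℚᵘ b 0)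

ι-^ : ∀ a L → ι (a ^ L) ≡ ι a ^ℚ L
ι-^ a zero    = refl
ι-^ a (suc L) = trans (ι-* a (a ^ L)) (cong (ι a ℚ.*_) (ι-^ a L))

divℚ-*-ι : ∀ a {d} → 0 < d → divℚ a d ℚ.* ι (+ d) ≡ ι a
divℚ-*-ι a {suc d} _ = trans (sym (fromℚᵘ-* (mkℚᵘ a d) (mkℚᵘ (+ suc d) 0)))
  (ℚ.fromℚᵘ-cong {mkℚᵘ a d ℚᵘ.* mkℚᵘ (+ suc d) 0} {mkℚᵘ a 0}
    (*≡* (trans (ℤ.*-identityʳ (a * + suc d)) (cong (λ e → a * + e) (sym (ℕ.*-identityʳ (suc d)))))))

*-cancelʳ-ι : ∀ {d x y} → 0 < d → x ℚ.* ι (+ d) ≡ y ℚ.* ι (+ d) → x ≡ y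
*-cancelʳ-ι {d} {x} {y} d>0 eq = begin
  x                                ≡⟨ ℚ.*-identityʳ x ⟨
  x ℚ.* 1ℚ                         ≡⟨ cong (x ℚ.*_) ι[d]*d⁻¹≡1 ⟨
  x ℚ.* (ι (+ d) ℚ.* d⁻¹)          ≡⟨ ℚ.*-assoc x (ι (+ d)) d⁻¹ ⟨
  x ℚ.* ι (+ d) ℚ.* d⁻¹            ≡⟨ cong (ℚ._* d⁻¹) eq ⟩
  y ℚ.* ι (+ d) ℚ.* d⁻¹            ≡⟨ ℚ.*-assoc y (ι (+ d)) d⁻¹ ⟩
  y ℚ.* (ι (+ d) ℚ.* d⁻¹)          ≡⟨ cong (y ℚ.*_) ι[d]*d⁻¹≡1 ⟩
  y ℚ.* 1ℚ                         ≡⟨ ℚ.*-identityʳ y ⟩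
  y                                ∎
  where
  d⁻¹ = divℚ 1ℤ d
  ι[d]*d⁻¹≡1 : ι (+ d) ℚ.* d⁻¹ ≡ 1ℚ
  ι[d]*d⁻¹≡1 = trans (ℚ.*-comm (ι (+ d)) d⁻¹) (divℚ-*-ι 1ℤ d>0)

^ℚ-distribʳ-* : ∀ x y L → (x ℚ.* y) ^ℚ L ≡ (x ^ℚ L) ℚ.* (y ^ℚ L)
^ℚ-distribʳ-* x y zero    = refl
^ℚ-distribʳ-* x y (suc L) =
  trans (cong ((x ℚ.* y) ℚ.*_) (^ℚ-distribʳ-* x y L)) (*ℚ-interchange x y (x ^ℚ L) (y ^ℚ L))

∑ℚ : List ℕ → (ℕ → ℚ) → ℚ
∑ℚ xs f = foldr (λ i s → f i ℚ.+ s) 0ℚ xs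

ι-∑ : ∀ xs f → ι (∑ xs f) ≡ ∑ℚ xs (ι ∘ f)
ι-∑ []       f = refl
ι-∑ (x ∷ xs) f = trans (ι-+ (f x) (∑ xs f)) (cong (ι (f x) ℚ.+_) (ι-∑ xs f))

∑ℚ-cong : ∀ xs {f g} → (∀ i → f i ≡ g i) → ∑ℚ xs f ≡ ∑ℚ xs g
∑ℚ-cong []       f≗g = refl
∑ℚ-cong (x ∷ xs) f≗g = cong₂ ℚ._+_ (f≗g x) (∑ℚ-cong xs f≗g)

∑ℚ-*ʳ : ∀ xs f c → ∑ℚ xs f ℚ.* c ≡ ∑ℚ xs (λ i → f i ℚ.* c)
∑ℚ-*ʳ []       f c = ℚ.*-zeroˡ c
∑ℚ-*ʳ (x ∷ xs) f c = trans (ℚ.*-distribʳ-+ c (f x) (∑ℚ xs f)) (cong (f x ℚ.* c ℚ.+_) (∑ℚ-*ʳ xs f c))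

clear-denominator : ∀ {N} → 0 < N → ∀ c w L →
                    ι c ℚ.* (1ℚ ℚ.+ divℚ w N) ^ℚ L ℚ.* ι (+ (N ℕ.^ L)) ≡ ι (c * (+ N + w) ^ L)
clear-denominator {N} N>0 c w L = begin
  ι c ℚ.* q ^ℚ L ℚ.* ι (+ (N ℕ.^ L))
    ≡⟨ ℚ.*-assoc (ι c) (q ^ℚ L) _ ⟩
  ι c ℚ.* (q ^ℚ L ℚ.* ι (+ (N ℕ.^ L)))
    ≡⟨ cong (λ z → ι c ℚ.* (q ^ℚ L ℚ.* z)) (trans (cong ι (pos-^ N L)) (ι-^ (+ N) L)) ⟩
  ι c ℚ.* (q ^ℚ L ℚ.* ι (+ N) ^ℚ L)
    ≡⟨ cong (ι c ℚ.*_) (^ℚ-distribʳ-* q (ι (+ N)) L) ⟨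
  ι c ℚ.* (q ℚ.* ι (+ N)) ^ℚ L
    ≡⟨ cong (λ z → ι c ℚ.* z ^ℚ L) q*N ⟩
  ι c ℚ.* ι (+ N + w) ^ℚ L
    ≡⟨ cong (ι c ℚ.*_) (ι-^ (+ N + w) L) ⟨
  ι c ℚ.* ι ((+ N + w) ^ L)
    ≡⟨ ι-* c ((+ N + w) ^ L) ⟨
  ι (c * (+ N + w) ^ L) ∎
  where
  q = 1ℚ ℚ.+ divℚ w N
  q*N : q ℚ.* ι (+ N) ≡ ι (+ N + w)
  q*N = begin
    (1ℚ ℚ.+ divℚ w N) ℚ.* ι (+ N)            ≡⟨ ℚ.*-distribʳ-+ (ι (+ N)) 1ℚ (divℚ w N) ⟩
    1ℚ ℚ.* ι (+ N) ℚ.+ divℚ w N ℚ.* ι (+ N)  ≡⟨ cong₂ ℚ._+_ (ℚ.*-identityˡ (ι (+ N))) (divℚ-*-ι w N>0) ⟩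
    ι (+ N) ℚ.+ ι w                          ≡⟨ ι-+ (+ N) w ⟨
    ι (+ N + w)                              ∎

divide-by-powers : ∀ {P N} → 0 < P → 0 < N → ∀ n L (c w : ℕ → ℤ) Z →
                   + P * + Z ≡ sumℤ n (λ m → c m * (+ N + w m) ^ L) →
                   divℚ (+ Z) (N ℕ.^ L) ≡ divℚ 1ℤ P ℚ.* sumℚ n (λ m → ι (c m) ℚ.* (1ℚ ℚ.+ divℚ (w m) N) ^ℚ L)
divide-by-powers {P} {N} P>0 N>0 n L c w Z hyp = *-cancelʳ-ι P>0 (*-cancelʳ-ι Q>0 (begin
  divℚ (+ Z) Q ℚ.* ι (+ P) ℚ.* ι (+ Q)
    ≡⟨ *ℚ-exchange (divℚ (+ Z) Q) (ι (+ P)) (ι (+ Q)) ⟩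
  divℚ (+ Z) Q ℚ.* ι (+ Q) ℚ.* ι (+ P)
    ≡⟨ cong (ℚ._* ι (+ P)) (divℚ-*-ι (+ Z) Q>0) ⟩
  ι (+ Z) ℚ.* ι (+ P)
    ≡⟨ ι-* (+ Z) (+ P) ⟨
  ι (+ Z * + P)
    ≡⟨ cong ι (trans (ℤ.*-comm (+ Z) (+ P)) hyp) ⟩
  ι (sumℤ n (λ m → c m * (+ N + w m) ^ L))
    ≡⟨ ι-∑ (upTo (suc n)) (λ m → c m * (+ N + w m) ^ L) ⟩
  ∑ℚ (upTo (suc n)) (λ m → ι (c m * (+ N + w m) ^ L))
    ≡⟨ ∑ℚ-cong (upTo (suc n)) (λ m → clear-denominator N>0 (c m) (w m) L) ⟨
  ∑ℚ (upTo (suc n)) (λ m → F m ℚ.* ι (+ Q))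
    ≡⟨ ∑ℚ-*ʳ (upTo (suc n)) F (ι (+ Q)) ⟨
  S ℚ.* ι (+ Q)
    ≡⟨ ℚ.*-identityˡ (S ℚ.* ι (+ Q)) ⟨
  1ℚ ℚ.* (S ℚ.* ι (+ Q))
    ≡⟨ cong (ℚ._* (S ℚ.* ι (+ Q))) (divℚ-*-ι 1ℤ P>0) ⟨
  divℚ 1ℤ P ℚ.* ι (+ P) ℚ.* (S ℚ.* ι (+ Q))
    ≡⟨ ℚ.*-assoc (divℚ 1ℤ P ℚ.* ι (+ P)) S (ι (+ Q)) ⟨
  divℚ 1ℤ P ℚ.* ι (+ P) ℚ.* S ℚ.* ι (+ Q)
    ≡⟨ cong (ℚ._* ι (+ Q)) (*ℚ-exchange (divℚ 1ℤ P) (ι (+ P)) S) ⟩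
  divℚ 1ℤ P ℚ.* S ℚ.* ι (+ P) ℚ.* ι (+ Q) ∎))
  where
  Q = N ℕ.^ L
  Q>0 : 0 < Q
  Q>0 = ℕ.m^n>0 N {{ℕ.>-nonZero N>0}} L
  F : ℕ → ℚ
  F m = ι (c m) ℚ.* (1ℚ ℚ.+ divℚ (w m) N) ^ℚ L
  S = sumℚ n F

nCk>0 : ∀ {n k} → k ≤ n → 0 < n C k
nCk>0 {n}     {zero}  _         = s≤s z≤n
nCk>0 {suc n} {suc k} (s≤s k≤n) =
  subst (0 <_) (nCk+nC[k+1]≡[n+1]C[k+1] n k) (ℕ.<-≤-trans (nCk>0 k≤n) (ℕ.m≤m+n (n C k) (n C suc k)))

proposition2 : (k n L : ℕ) → 3 ≤ k → k ≤ n →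
    E L n k ≡ divℚ (+ 1) (2 ℕ.^ n)
      ℚ.* sumℚ n (λ m → divℚ (+ (n C m)) 1 ℚ.* ((1ℚ ℚ.+ divℚ (ω n m k) (n C k)) ^ℚ L))
proposition2 k n L _ k≤n = begin
  E L n k
    ≡⟨ cong (divℚ (+ ΣY)) (length-M L n k) ⟩
  divℚ (+ ΣY) ((n C k) ℕ.^ L)
    ≡⟨ divide-by-powers (ℕ.m^n>0 2 n) (nCk>0 k≤n) n L (binom n) (λ m → ω n m k) ΣY (kernel-count L n k) ⟩
  divℚ (+ 1) (2 ℕ.^ n) ℚ.* sumℚ n (λ m → ι (binom n m) ℚ.* (1ℚ ℚ.+ divℚ (ω n m k) (n C k)) ^ℚ L) ∎
  where
  ΣY = foldr (λ A s → Y A ℕ.+ s) 0 (M L n k)
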